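{- Let $m,n\ge 2$ and let $P_m,P_n$ be paths on $m$ and $n$ vertices. Let $\Delta$ be the maximum degree of $P_m\times P_n$. Then $$\chi''_{\Sigma}(P_m\times P_n)=\begin{cases}\Delta+1 & \text{if } m=n=3,\\ \Delta+2 & \text{otherwise.}\end{cases}$$
   Context: All graphs are finite and simple. A proper total $k$-coloring of a graph $G$ assigns to every vertex and every edge a color from $\{1,\dots,k\}$ such that adjacent vertices receive different colors, edges sharing an endpoint receive different colors, and no edge receives the same color as either of its endpoints. For such a coloring $c$ and a vertex $v$, let $f(v)=c(v)+\sum_{e\ni v} c(e)$. The coloring distinguishes adjacent vertices by sums if $f(u)\neq f(v)$ for every edge $uv$. $\chi''_{\Sigma}(G)$ denotes the smallest $k$ such that $G$ has a proper total $k$-coloring distinguishing adjacent vertices by sums. The product $G_1\times G_2$ is the Cartesian product: vertex set $V(G_1)\times V(G_2)$, with $(u_1,u_2)$ adjacent to $(v_1,v_2)$ iff either $u_1=v_1$ and $u_2v_2\in E(G_2)$, or $u_1v_1\in E(G_1)$ and $u_2=v_2$. -}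

module Defs where

open import Data.Bool using (Bool; true; false; _∧_; _∨_; if_then_else_; T)
open import Data.Nat using (ℕ; zero; suc; _+_; _*_; _≤_; _⊔_; _≡ᵇ_)
open import Data.Fin using (Fin; toℕ; quotient; remainder)
open import Data.Fin.Properties using () renaming (_≟_ to _≟ᶠ_)
open import Data.List using (List; map; foldr; allFin)
open import Data.Nat.ListAction using (sum)
open import Data.Bool.Properties using (∨-comm)
open import Data.Nat.Properties using (≡ᵇ⇒≡; 1+n≢n)
open import Relation.Binary.PropositionalEquality using (refl; sym; cong₂)
open import Data.Empty using (⊥-elim)
open import Data.Product using (_×_; Σ)
open import Relation.Nullary using (¬_; does)
open import Relation.Binary.PropositionalEquality using (_≡_; _≢_)

record Graph : Set where
  field
    order : ℕ
    adj   : Fin order → Fin order → Bool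
    adj-sym   : ∀ u v → adj u v ≡ adj v u
    adj-irr   : ∀ v → adj v v ≡ false
open Graph public

Adj : (G : Graph) → Fin (order G) → Fin (order G) → Set
Adj G u v = T (adj G u v)

degree : (G : Graph) → Fin (order G) → ℕ
degree G v = sum (map (λ u → if adj G v u then 1 else 0) (allFin (order G)))

maxDegree : (G : Graph) → ℕ
maxDegree G = foldr _⊔_ 0 (map (degree G) (allFin (order G)))

pathAdj : (m : ℕ) → Fin m → Fin m → Bool
pathAdj m i j = (suc (toℕ i) ≡ᵇ toℕ j) ∨ (suc (toℕ j) ≡ᵇ toℕ i)


private
  suc≡ᵇ-false : ∀ k → (suc k ≡ᵇ k) ≡ false
  suc≡ᵇ-false k with suc k ≡ᵇ k in eq
  ... | false = refl
  ... | true  = ⊥-elim (1+n≢n ((≡ᵇ⇒≡ (suc k) k (subst′ eq))))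
    where
    subst′ : ∀ {b} → b ≡ true → T b
    subst′ refl = _

pathAdj-sym : ∀ m (i j : Fin m) → pathAdj m i j ≡ pathAdj m j i
pathAdj-sym m i j = ∨-comm (suc (toℕ i) ≡ᵇ toℕ j) (suc (toℕ j) ≡ᵇ toℕ i)

pathAdj-irr : ∀ m (i : Fin m) → pathAdj m i i ≡ false
pathAdj-irr m i rewrite suc≡ᵇ-false (toℕ i) = refl

path : ℕ → Graph
path m = record { order = m ; adj = pathAdj m
                ; adj-sym = pathAdj-sym m ; adj-irr = pathAdj-irr m }

_==ᶠ_ : ∀ {k} → Fin k → Fin k → Bool
i ==ᶠ j = does (i ≟ᶠ j)

private
  ==ᶠ-sym : ∀ {k} (i j : Fin k) → (i ==ᶠ j) ≡ (j ==ᶠ i)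
  ==ᶠ-sym i j with i ≟ᶠ j | j ≟ᶠ i
  ... | Relation.Nullary.yes _ | Relation.Nullary.yes _ = refl
  ... | Relation.Nullary.no _  | Relation.Nullary.no _  = refl
  ... | Relation.Nullary.yes p | Relation.Nullary.no q  = ⊥-elim (q (sym p))
  ... | Relation.Nullary.no p  | Relation.Nullary.yes q = ⊥-elim (p (sym q))

-- Cartesian product G₁ × G₂ on vertex set Fin (order G₁ * order G₂);
-- vertex v corresponds to the pair (quotient v , remainder v)
-- (inverse of Data.Fin.combine).
module _ (G₁ G₂ : Graph) where
  private
    m = order G₁
    n = order G₂
    p₁ : Fin (m * n) → Fin m
    p₁ = quotient n
    p₂ : Fin (m * n) → Fin n
    p₂ = remainder {m} n

  prodAdj : Fin (m * n) → Fin (m * n) → Bool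
  prodAdj v w = ((p₁ v ==ᶠ p₁ w) ∧ adj G₂ (p₂ v) (p₂ w))
              ∨ (adj G₁ (p₁ v) (p₁ w) ∧ (p₂ v ==ᶠ p₂ w))

  private
    prodAdj-sym : ∀ v w → prodAdj v w ≡ prodAdj w v
    prodAdj-sym v w rewrite ==ᶠ-sym (p₁ v) (p₁ w) | ==ᶠ-sym (p₂ v) (p₂ w)
                          | adj-sym G₁ (p₁ v) (p₁ w) | adj-sym G₂ (p₂ v) (p₂ w) = refl

    prodAdj-irr : ∀ v → prodAdj v v ≡ false
    prodAdj-irr v rewrite adj-irr G₁ (p₁ v) | adj-irr G₂ (p₂ v) with p₁ v ==ᶠ p₁ v | p₂ v ==ᶠ p₂ v
    ... | true | true = refl
    ... | true | false = refl
    ... | false | true = refl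
    ... | false | false = refl

  _□_ : Graph
  _□_ = record { order = m * n ; adj = prodAdj
               ; adj-sym = prodAdj-sym ; adj-irr = prodAdj-irr }

-- Vertex colours: vc v; edge colours: ec u v (for adjacent u v),
-- required symmetric so that it is a function of the edge {u,v}.
record SumDistTotalColouring (G : Graph) (k : ℕ) : Set where
  field
    vc : Fin (order G) → ℕ
    ec : Fin (order G) → Fin (order G) → ℕ
    vc-range : ∀ v → 1 ≤ vc v × vc v ≤ k
    ec-range : ∀ u v → Adj G u v → 1 ≤ ec u v × ec u v ≤ k
    ec-sym   : ∀ u v → Adj G u v → ec u v ≡ ec v u
    proper-vv : ∀ u v → Adj G u v → vc u ≢ vc v
    proper-ee : ∀ v u w → Adj G v u → Adj G v w → u ≢ w → ec v u ≢ ec v w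
    proper-ve : ∀ u v → Adj G u v → ec u v ≢ vc u × ec u v ≢ vc v
  wsum : Fin (order G) → ℕ
  wsum v = vc v + sum (map (λ u → if adj G v u then ec v u else 0) (allFin (order G)))
  field
    distinguishing : ∀ u v → Adj G u v → wsum u ≢ wsum v

IsTotalSumChromatic : Graph → ℕ → Set
IsTotalSumChromatic G k =
  SumDistTotalColouring G k × (∀ j → SumDistTotalColouring G j → k ≤ j)

-- With k colours, a vertex of degree d and its d incident edges carry d + 1 distinct colours
-- from {1, …, k}; so k > d, and if k = d + 1 these colours are exactly 1, …, d + 1 and the
-- sum at the vertex is forced to be 1 + ⋯ + (d + 1). Two adjacent vertices of maximum degree Δ
-- therefore force at least Δ + 2 colours, and every Pₘ □ Pₙ other than P₃ □ P₃ has such a pair;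
-- in P₃ □ P₃ only the centre has degree 4, which gives just Δ + 1.
-- Matching colourings: colour the vertices 1 and 2 like a chessboard, the horizontal edges in
-- column j by a or b and the vertical edges in row i by p or q according to parity, with
-- a, b, p, q ≥ 3. Adjacent vertices then get vertex colours differing by 1, while their edge
-- sums agree or differ by a single edge colour, which is at least 3. For P₃ □ P₃ an explicit
-- colouring with 5 colours is verified by evaluation.
module Submission where

open import Defs
open import Data.Bool using (Bool; true; false; if_then_else_; T; _∨_)
open import Data.Bool.Properties using (T-≡; T-∨; T-∧)
open import Data.Fin using (Fin; toℕ; combine; quotient; remainder; _↑ˡ_; _↑ʳ_)
  renaming (zero to fzero; suc to fsuc)
open import Data.Fin.Properties using (remQuot-combine; combine-remQuot; toℕ<n; toℕ-injective)
  renaming (_≟_ to _≟ᶠ_)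
open import Data.List using (List; []; _∷_; _++_; length; map; filter; allFin; foldr; tabulate)
open import Data.List.Properties using (length-map; tabulate-cong; map-tabulate)
open import Data.List.Membership.Propositional using (_∈_)
open import Data.List.Membership.Propositional.Properties using (∈-∃++; ∈-map⁺; ∈-allFin)
open import Data.List.Relation.Binary.Permutation.Propositional using (_↭_; ↭⇒↭ₛ)
open import Data.List.Relation.Binary.Permutation.Propositional.Properties using (shift; All-resp-↭; ↭-length)
import Data.List.Relation.Binary.Permutation.Setoid.Properties as ↭ₛ
open import Data.List.Relation.Unary.All as All using (All; []; _∷_)
import Data.List.Relation.Unary.All.Properties as All
open import Data.List.Relation.Unary.AllPairs using (AllPairs; []; _∷_)
import Data.List.Relation.Unary.AllPairs.Properties as AllPairs
open import Data.List.Relation.Unary.Any using (here; there)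
open import Data.List.Relation.Unary.Unique.Propositional using (Unique)
import Data.List.Relation.Unary.Unique.Propositional.Properties as Unique
open import Data.Nat using (ℕ; zero; suc; _+_; _*_; _⊔_; _⊓_; _≤_; _<_; _≤?_; _≡ᵇ_; _<ᵇ_; _≤ᵇ_; z≤n; s≤s; s≤s⁻¹)
open import Data.Nat.ListAction using (sum)
open import Data.Nat.ListAction.Properties using (sum-↭)
open import Data.Nat.Properties
  using (_≟_; suc-injective; ≡ᵇ⇒≡; <⇒<ᵇ; ≤ᵇ⇒≤; ≤-refl; ≤-reflexive; ≤-trans; ≤-antisym; <⇒≤; n≤1+n; 1+n≰n; ≤∧≢⇒<
        ; m≤n⇒m<n∨m≡n; +-comm; +-assoc; +-suc; +-identityʳ; +-commutativeSemigroup; +-mono-≤; +-monoˡ-≤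
        ; +-cancelʳ-≡; +-cancelʳ-≤; m≤n+m; ⊔-lub; m≤m⊔n; m≤n⊔m; m≤n⇒m⊓n≡m; m≥n⇒m⊓n≡n; allUpTo?)
open import Algebra.Properties.CommutativeSemigroup +-commutativeSemigroup using (interchange)
open import Data.List.Membership.DecPropositional _≟_ using (_∈?_)
open import Data.Product using (_×_; _,_; ∃-syntax; proj₁; proj₂)
open import Data.Sum using (_⊎_; inj₁; inj₂)
open import Function using (_∘_; id; Equivalence)
open import Relation.Binary.PropositionalEquality
  using (_≡_; _≢_; ≢-sym; refl; sym; trans; cong; cong₂; subst; subst₂; setoid; module ≡-Reasoning)
open import Relation.Nullary using (¬_; Dec; yes; no; ¬?)
open import Relation.Nullary.Decidable using (T?; True; toWitness; dec-true; _×-dec_)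
open import Relation.Nullary.Negation using (contradiction)

-- Sets of distinct colours from {1, …, k}

InPalette : ℕ → ℕ → Set
InPalette k x = 1 ≤ x × x ≤ k

triangle : ℕ → ℕ
triangle zero    = 0
triangle (suc k) = suc k + triangle k

∈⇒↭∷ : ∀ {x} {xs : List ℕ} → x ∈ xs → ∃[ ws ] xs ↭ x ∷ ws
∈⇒↭∷ {x} x∈xs with ys , zs , refl ← ∈-∃++ x∈xs = ys ++ zs , shift x ys zs

Unique-resp-↭ : ∀ {xs ys : List ℕ} → xs ↭ ys → Unique xs → Unique ys
Unique-resp-↭ p = ↭ₛ.Unique-resp-↭ (setoid ℕ) (↭⇒↭ₛ p)

InPalette-shrink : ∀ {k} {xs : List ℕ} → All (InPalette (suc k)) xs → All (suc k ≢_) xs → All (InPalette k) xs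
InPalette-shrink xs∈P xs≢top =
  All.zipWith (λ ((1≤x , x≤1+k) , 1+k≢x) → 1≤x , s≤s⁻¹ (≤∧≢⇒< x≤1+k (1+k≢x ∘ sym))) (xs∈P , xs≢top)

remove-top : ∀ {k} {xs : List ℕ} → suc k ∈ xs → Unique xs → All (InPalette (suc k)) xs →
  ∃[ ws ] (xs ↭ suc k ∷ ws) × Unique ws × All (InPalette k) ws
remove-top top∈xs !xs xs∈P
  with ws , xs↭ ← ∈⇒↭∷ top∈xs
  with top≢ws ∷ !ws ← Unique-resp-↭ xs↭ !xs
  with _ ∷ ws∈P ← All-resp-↭ xs↭ xs∈P
  = ws , xs↭ , !ws , InPalette-shrink ws∈P top≢ws

length≤palette : ∀ k {xs : List ℕ} → Unique xs → All (InPalette k) xs → length xs ≤ k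
length≤palette zero    _   []                  = z≤n
length≤palette zero    _   ((1≤x , x≤0) ∷ _)   = contradiction (≤-trans 1≤x x≤0) λ ()
length≤palette (suc k) {xs} !xs xs∈P with suc k ∈? xs
... | yes top∈xs =
  let ws , xs↭ , !ws , ws∈P = remove-top top∈xs !xs xs∈P
  in  subst (_≤ suc k) (sym (↭-length xs↭)) (s≤s (length≤palette k !ws ws∈P))
... | no  top∉xs =
  ≤-trans (length≤palette k !xs (InPalette-shrink xs∈P (All.¬Any⇒All¬ xs top∉xs))) (n≤1+n k)

sum≡triangle : ∀ {xs : List ℕ} → Unique xs → All (InPalette (length xs)) xs → sum xs ≡ triangle (length xs)
sum≡triangle {xs} !xs xs∈P = go (length xs) refl !xs xs∈P
  where
  go : ∀ k {xs} → length xs ≡ k → Unique xs → All (InPalette k) xs → sum xs ≡ triangle k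
  go zero    {[]} _ _ _ = refl
  go (suc k) {xs} len !xs xs∈P with suc k ∈? xs
  ... | yes top∈xs =
    let ws , xs↭ , !ws , ws∈P = remove-top top∈xs !xs xs∈P
    in  trans (sum-↭ xs↭) (cong (suc k +_) (go k (suc-injective (trans (sym (↭-length xs↭)) len)) !ws ws∈P))
  ... | no  top∉xs = contradiction
    (subst (_≤ k) len (length≤palette k !xs (InPalette-shrink xs∈P (All.¬Any⇒All¬ xs top∉xs)))) 1+n≰n

-- Lower bounds in an arbitrary graph

nbSum : (G : Graph) → Fin (order G) → (Fin (order G) → ℕ) → ℕ
nbSum G v h = sum (map (λ u → if adj G v u then h u else 0) (allFin (order G)))

neighbours : (G : Graph) → Fin (order G) → List (Fin (order G))
neighbours G v = filter (T? ∘ adj G v) (allFin (order G))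

sum-map-if : ∀ {A : Set} (p : A → Bool) (h : A → ℕ) xs →
  sum (map (λ x → if p x then h x else 0) xs) ≡ sum (map h (filter (T? ∘ p) xs))
sum-map-if p h [] = refl
sum-map-if p h (x ∷ xs) with p x
... | true  = cong (h x +_) (sum-map-if p h xs)
... | false = sum-map-if p h xs

sum-map-const-1 : ∀ {A : Set} (xs : List A) → sum (map (λ _ → 1) xs) ≡ length xs
sum-map-const-1 []       = refl
sum-map-const-1 (x ∷ xs) = cong suc (sum-map-const-1 xs)

nbSum≡sum-neighbours : ∀ G v h → nbSum G v h ≡ sum (map h (neighbours G v))
nbSum≡sum-neighbours G v h = sum-map-if (adj G v) h (allFin (order G))

degree≡length-neighbours : ∀ G v → degree G v ≡ length (neighbours G v)
degree≡length-neighbours G v = trans (nbSum≡sum-neighbours G v (λ _ → 1)) (sum-map-const-1 (neighbours G v))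

neighbours-unique : ∀ G v → Unique (neighbours G v)
neighbours-unique G v = Unique.filter⁺ (T? ∘ adj G v) (Unique.allFin⁺ (order G))

neighbours-adjacent : ∀ G v → All (Adj G v) (neighbours G v)
neighbours-adjacent G v = All.all-filter (T? ∘ adj G v) (allFin (order G))

allPairs-restrict : ∀ {A : Set} {P : A → Set} {R S : A → A → Set} →
  (∀ {x y} → P x → P y → R x y → S x y) → ∀ {xs} → All P xs → AllPairs R xs → AllPairs S xs
allPairs-restrict f []         []         = []
allPairs-restrict f (px ∷ pxs) (rx ∷ rxs) =
  All.zipWith (λ (py , r) → f px py r) (pxs , rx) ∷ allPairs-restrict f pxs rxs

module StarColours {G : Graph} {k : ℕ} (c : SumDistTotalColouring G k) (v : Fin (order G)) where
  open SumDistTotalColouring c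

  starColours : List ℕ
  starColours = vc v ∷ map (ec v) (neighbours G v)

  wsum≡sum : wsum v ≡ sum starColours
  wsum≡sum = cong (vc v +_) (nbSum≡sum-neighbours G v (ec v))

  length≡ : length starColours ≡ suc (degree G v)
  length≡ = cong suc (trans (length-map (ec v) (neighbours G v)) (sym (degree≡length-neighbours G v)))

  unique : Unique starColours
  unique = All.map⁺ (All.map (λ a e → proj₁ (proper-ve v _ a) (sym e)) (neighbours-adjacent G v))
         ∷ AllPairs.map⁺ (allPairs-restrict (proper-ee v _ _) (neighbours-adjacent G v) (neighbours-unique G v))

  inPalette : All (InPalette k) starColours
  inPalette = vc-range v ∷ All.map⁺ (All.map (ec-range v _) (neighbours-adjacent G v))

degree<colours : ∀ {G k} → SumDistTotalColouring G k → ∀ v → degree G v < k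
degree<colours {k = k} c v = subst (_≤ k) length≡ (length≤palette k unique inPalette)
  where open StarColours c v

wsum≡triangle : ∀ {G k} (c : SumDistTotalColouring G k) v → k ≡ suc (degree G v) →
  SumDistTotalColouring.wsum c v ≡ triangle k
wsum≡triangle {k = k} c v k≡ = begin
  SumDistTotalColouring.wsum c v  ≡⟨ wsum≡sum ⟩
  sum starColours                 ≡⟨ sum≡triangle unique (subst (λ l → All (InPalette l) starColours) (sym len) inPalette) ⟩
  triangle (length starColours)   ≡⟨ cong triangle len ⟩
  triangle k                      ∎
  where
  open StarColours c v
  open ≡-Reasoning
  len : length starColours ≡ k
  len = trans length≡ (sym k≡)

adjacent-degree-bound : ∀ {G k d} → SumDistTotalColouring G k → ∀ {u v} → Adj G u v →
  degree G u ≡ d → degree G v ≡ d → 2 + d ≤ k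
adjacent-degree-bound c {u} {v} u~v refl dv≡du with m≤n⇒m<n∨m≡n (degree<colours c u)
... | inj₁ 2+d≤k = 2+d≤k
... | inj₂ 1+d≡k = contradiction
  (trans (wsum≡triangle c u (sym 1+d≡k)) (sym (wsum≡triangle c v (trans (sym 1+d≡k) (cong suc (sym dv≡du))))))
  (SumDistTotalColouring.distinguishing c u v u~v)

foldr-⊔-lub : ∀ {d} (xs : List ℕ) → All (_≤ d) xs → foldr _⊔_ 0 xs ≤ d
foldr-⊔-lub []       []           = z≤n
foldr-⊔-lub (x ∷ xs) (x≤d ∷ xs≤d) = ⊔-lub x≤d (foldr-⊔-lub xs xs≤d)

foldr-⊔-upper : ∀ {x} {xs : List ℕ} → x ∈ xs → x ≤ foldr _⊔_ 0 xs
foldr-⊔-upper {xs = y ∷ xs} (here refl) = m≤m⊔n y _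
foldr-⊔-upper {xs = y ∷ xs} (there x∈xs) = ≤-trans (foldr-⊔-upper x∈xs) (m≤n⊔m y _)

maxDegree-≡ : ∀ G {d} w → (∀ v → degree G v ≤ d) → degree G w ≡ d → maxDegree G ≡ d
maxDegree-≡ G w deg≤d deg-w≡d = ≤-antisym
  (foldr-⊔-lub _ (All.map⁺ (All.tabulate⁺ deg≤d)))
  (subst (_≤ maxDegree G) deg-w≡d (foldr-⊔-upper (∈-map⁺ (degree G) (∈-allFin w))))

chromatic-Δ+2 : ∀ {G d} u v → maxDegree G ≡ d → SumDistTotalColouring G (d + 2) → Adj G u v →
  degree G u ≡ d → degree G v ≡ d → IsTotalSumChromatic G (maxDegree G + 2)
chromatic-Δ+2 {d = d} u v refl c u~v du dv = c , λ k c' → subst (_≤ k) (+-comm 2 d) (adjacent-degree-bound c' u~v du dv)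

chromatic-Δ+1 : ∀ {G d} w → maxDegree G ≡ d → SumDistTotalColouring G (d + 1) → degree G w ≡ d →
  IsTotalSumChromatic G (maxDegree G + 1)
chromatic-Δ+1 {d = d} w refl c dw = c , λ k c' → subst (_≤ k) (trans (cong suc dw) (+-comm 1 d)) (degree<colours c' w)

-- Neighbour sums in paths and Cartesian products

≡ᵇ-refl : ∀ n → (n ≡ᵇ n) ≡ true
≡ᵇ-refl zero    = refl
≡ᵇ-refl (suc n) = ≡ᵇ-refl n

n≡ᵇ1+n : ∀ n → (n ≡ᵇ suc n) ≡ false
n≡ᵇ1+n zero    = refl
n≡ᵇ1+n (suc n) = n≡ᵇ1+n n

≡ᵇ-comm : ∀ m n → (m ≡ᵇ n) ≡ (n ≡ᵇ m)
≡ᵇ-comm zero    zero    = refl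
≡ᵇ-comm zero    (suc n) = refl
≡ᵇ-comm (suc m) zero    = refl
≡ᵇ-comm (suc m) (suc n) = ≡ᵇ-comm m n

≡ᵇ-true⇒≡ : ∀ {m n} → (m ≡ᵇ n) ≡ true → m ≡ n
≡ᵇ-true⇒≡ {m} {n} eq = ≡ᵇ⇒≡ m n (subst T (sym eq) _)

<ᵇ-true : ∀ {m n} → m < n → (m <ᵇ n) ≡ true
<ᵇ-true m<n = Equivalence.to T-≡ (<⇒<ᵇ m<n)

sumFin : ∀ n → (Fin n → ℕ) → ℕ
sumFin n f = sum (tabulate f)

sumFin-cong : ∀ {n} {f g : Fin n → ℕ} → (∀ i → f i ≡ g i) → sumFin n f ≡ sumFin n g
sumFin-cong f≗g = cong sum (tabulate-cong f≗g)

sumFin-zero : ∀ n → sumFin n (λ _ → 0) ≡ 0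
sumFin-zero zero    = refl
sumFin-zero (suc n) = sumFin-zero n

sumFin-+ : ∀ {n} (f g : Fin n → ℕ) → sumFin n (λ i → f i + g i) ≡ sumFin n f + sumFin n g
sumFin-+ {zero}  f g = refl
sumFin-+ {suc n} f g = trans (cong (f fzero + g fzero +_) (sumFin-+ (f ∘ fsuc) (g ∘ fsuc)))
                             (interchange (f fzero) (g fzero) _ _)

sumFin-if : ∀ {n} b (f : Fin n → ℕ) → sumFin n (λ i → if b then f i else 0) ≡ (if b then sumFin n f else 0)
sumFin-if true  f = refl
sumFin-if {n} false f = sumFin-zero n

sumFin-point : ∀ {n} (v : Fin n) (f : Fin n → ℕ) → sumFin n (λ i → if v ==ᶠ i then f i else 0) ≡ f v
sumFin-point {suc n} fzero    f = trans (cong (f fzero +_) (sumFin-zero n)) (+-identityʳ _)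
sumFin-point {suc n} (fsuc v) f = sumFin-point v (f ∘ fsuc)

sumFin-↑ : ∀ m {n} (f : Fin (m + n) → ℕ) → sumFin (m + n) f ≡ sumFin m (f ∘ (_↑ˡ n)) + sumFin n (f ∘ (m ↑ʳ_))
sumFin-↑ zero    f = refl
sumFin-↑ (suc m) f = trans (cong (f fzero +_) (sumFin-↑ m (f ∘ fsuc))) (sym (+-assoc (f fzero) _ _))

sumFin-combine : ∀ m {n} (f : Fin (m * n) → ℕ) → sumFin (m * n) f ≡ sumFin m (λ a → sumFin n (λ b → f (combine a b)))
sumFin-combine zero    f = refl
sumFin-combine (suc m) {n} f =
  trans (sumFin-↑ n f) (cong (sumFin n (f ∘ (_↑ˡ m * n)) +_) (sumFin-combine m (f ∘ (n ↑ʳ_))))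

nbSum≡sumFin : ∀ G v h → nbSum G v h ≡ sumFin (order G) (λ u → if adj G v u then h u else 0)
nbSum≡sumFin G v h = cong sum (map-tabulate {n = order G} id (λ u → if adj G v u then h u else 0))

sumFin-at : ∀ n c (f : ℕ → ℕ) →
  sumFin n (λ u → if c ≡ᵇ toℕ u then f (toℕ u) else 0) ≡ (if c <ᵇ n then f c else 0)
sumFin-at zero    c       f = refl
sumFin-at (suc n) zero    f = trans (cong (f 0 +_) (sumFin-zero n)) (+-identityʳ (f 0))
sumFin-at (suc n) (suc c) f = sumFin-at n c (f ∘ suc)

before : ℕ → (ℕ → ℕ) → ℕ
before zero    g = 0
before (suc j) g = g j

after : ℕ → ℕ → (ℕ → ℕ) → ℕ
after n j g = if suc j <ᵇ n then g (suc j) else 0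

pathNbSum : ℕ → ℕ → (ℕ → ℕ) → ℕ
pathNbSum n j g = before j g + after n j g

path-adj-split : ∀ j k (t : ℕ) → (if (suc j ≡ᵇ k) ∨ (suc k ≡ᵇ j) then t else 0)
  ≡ (if suc k ≡ᵇ j then t else 0) + (if suc j ≡ᵇ k then t else 0)
path-adj-split j k t with suc j ≡ᵇ k in 1+j≡k | suc k ≡ᵇ j in 1+k≡j
... | false | false = refl
... | false | true  = sym (+-identityʳ t)
... | true  | false = refl
... | true  | true  = contradiction
  (subst (suc j ≤_) (trans (cong suc (≡ᵇ-true⇒≡ 1+j≡k)) (≡ᵇ-true⇒≡ 1+k≡j)) (n≤1+n (suc j))) 1+n≰n

sumFin-at-pred : ∀ n j (g : ℕ → ℕ) → j ≤ n →
  sumFin n (λ u → if suc (toℕ u) ≡ᵇ j then g (toℕ u) else 0) ≡ before j g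
sumFin-at-pred n zero    g _   = sumFin-zero n
sumFin-at-pred n (suc j) g j<n = begin
  sumFin n (λ u → if toℕ u ≡ᵇ j then g (toℕ u) else 0)
    ≡⟨ sumFin-cong {n} (λ u → cong (λ b → if b then g (toℕ u) else 0) (≡ᵇ-comm (toℕ u) j)) ⟩
  sumFin n (λ u → if j ≡ᵇ toℕ u then g (toℕ u) else 0)
    ≡⟨ sumFin-at n j g ⟩
  (if j <ᵇ n then g j else 0)
    ≡⟨ cong (λ b → if b then g j else 0) (<ᵇ-true j<n) ⟩
  g j ∎
  where open ≡-Reasoning

nbSum-path : ∀ n (j : Fin n) (h : Fin n → ℕ) (g : ℕ → ℕ) → (∀ u → h u ≡ g (toℕ u)) →
  nbSum (path n) j h ≡ pathNbSum n (toℕ j) g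
nbSum-path n j h g h≗g = begin
  nbSum (path n) j h
    ≡⟨ nbSum≡sumFin (path n) j h ⟩
  sumFin n (λ u → if pathAdj n j u then h u else 0)
    ≡⟨ sumFin-cong (λ u → trans (cong (λ t → if pathAdj n j u then t else 0) (h≗g u))
                                (path-adj-split (toℕ j) (toℕ u) (g (toℕ u)))) ⟩
  sumFin n (λ u → (if suc (toℕ u) ≡ᵇ toℕ j then g (toℕ u) else 0) + (if suc (toℕ j) ≡ᵇ toℕ u then g (toℕ u) else 0))
    ≡⟨ sumFin-+ {n} _ _ ⟩
  _ ≡⟨ cong₂ _+_ (sumFin-at-pred n (toℕ j) g (<⇒≤ (toℕ<n j))) (sumFin-at n (suc (toℕ j)) g) ⟩
  pathNbSum n (toℕ j) g ∎
  where open ≡-Reasoning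

path-adj⁻ : ∀ {n} {a b : Fin n} → Adj (path n) a b → suc (toℕ a) ≡ toℕ b ⊎ suc (toℕ b) ≡ toℕ a
path-adj⁻ a~b with Equivalence.to T-∨ a~b
... | inj₁ t = inj₁ (≡ᵇ⇒≡ _ _ t)
... | inj₂ t = inj₂ (≡ᵇ⇒≡ _ _ t)

pathDegree : ℕ → ℕ → ℕ
pathDegree n j = pathNbSum n j (λ _ → 1)

pathDegree≤2 : ∀ n j → pathDegree n j ≤ 2
pathDegree≤2 n j = +-mono-≤ (before≤1 j) (after≤1 (suc j <ᵇ n))
  where
  before≤1 : ∀ j → before j (λ _ → 1) ≤ 1
  before≤1 zero    = z≤n
  before≤1 (suc j) = ≤-refl
  after≤1 : ∀ b → (if b then 1 else 0) ≤ 1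
  after≤1 true  = ≤-refl
  after≤1 false = z≤n

pathDegree-P₂ : ∀ j → j < 2 → pathDegree 2 j ≤ 1
pathDegree-P₂ zero          _ = ≤-refl
pathDegree-P₂ (suc zero)    _ = ≤-refl
pathDegree-P₂ (suc (suc _)) (s≤s (s≤s ()))

==ᶠ⇒≡ : ∀ {k} {i j : Fin k} → T (i ==ᶠ j) → i ≡ j
==ᶠ⇒≡ {i = i} {j} i==j with i ≟ᶠ j
... | yes i≡j = i≡j

module _ (G₁ G₂ : Graph) where
  private
    m = order G₁
    n = order G₂

  quotient-combine : ∀ (a : Fin m) (b : Fin n) → quotient n (combine a b) ≡ a
  quotient-combine a b = cong proj₁ (remQuot-combine a b)

  remainder-combine : ∀ (a : Fin m) (b : Fin n) → remainder {m} n (combine a b) ≡ b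
  remainder-combine a b = cong proj₂ (remQuot-combine a b)

  □-adj-split : ∀ v a b (t : ℕ) →
    (if adj (G₁ □ G₂) v (combine a b) then t else 0)
      ≡ (if quotient n v ==ᶠ a then (if adj G₂ (remainder {m} n v) b then t else 0) else 0)
      + (if adj G₁ (quotient n v) a then (if remainder {m} n v ==ᶠ b then t else 0) else 0)
  □-adj-split v a b t
    rewrite quotient-combine a b | remainder-combine a b
    with quotient n v ≟ᶠ a
  ... | no _ with adj G₁ (quotient n v) a
  ...   | true  = refl
  ...   | false = refl
  □-adj-split v a b t | yes refl rewrite adj-irr G₁ (quotient n v)
    with adj G₂ (remainder {m} n v) b
  ...   | true  = sym (+-identityʳ t)
  ...   | false = refl

  nbSum-□ : ∀ v (h : Fin (m * n) → ℕ) → nbSum (G₁ □ G₂) v h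
    ≡ nbSum G₂ (remainder {m} n v) (λ b → h (combine (quotient {m} n v) b))
    + nbSum G₁ (quotient {m} n v) (λ a → h (combine a (remainder {m} n v)))
  nbSum-□ v h = begin
    nbSum (G₁ □ G₂) v h
      ≡⟨ nbSum≡sumFin (G₁ □ G₂) v h ⟩
    sumFin (m * n) (λ u → if adj (G₁ □ G₂) v u then h u else 0)
      ≡⟨ sumFin-combine m _ ⟩
    sumFin m (λ a → sumFin n (λ b → if adj (G₁ □ G₂) v (combine a b) then h (combine a b) else 0))
      ≡⟨ sumFin-cong (λ a → trans (sumFin-cong (λ b → □-adj-split v a b (h (combine a b)))) (sumFin-+ {n} _ _)) ⟩
    sumFin m (λ a → sumFin n (row a) + sumFin n (column a))
      ≡⟨ sumFin-+ {m} _ _ ⟩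
    sumFin m (λ a → sumFin n (row a)) + sumFin m (λ a → sumFin n (column a))
      ≡⟨ cong₂ _+_ row-sum column-sum ⟩
    nbSum G₂ b₀ (λ b → h (combine a₀ b)) + nbSum G₁ a₀ (λ a → h (combine a b₀))
      ∎
    where
    open ≡-Reasoning
    a₀ = quotient {m} n v
    b₀ = remainder {m} n v
    row column : Fin m → Fin n → ℕ
    row    a b = if a₀ ==ᶠ a then (if adj G₂ b₀ b then h (combine a b) else 0) else 0
    column a b = if adj G₁ a₀ a then (if b₀ ==ᶠ b then h (combine a b) else 0) else 0

    row-sum : sumFin m (λ a → sumFin n (row a)) ≡ nbSum G₂ b₀ (λ b → h (combine a₀ b))
    row-sum = trans (sumFin-cong (λ a → sumFin-if {n} (a₀ ==ᶠ a) _))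
             (trans (sumFin-point {m} a₀ _) (sym (nbSum≡sumFin G₂ b₀ _)))

    column-sum : sumFin m (λ a → sumFin n (column a)) ≡ nbSum G₁ a₀ (λ a → h (combine a b₀))
    column-sum = trans (sumFin-cong (λ a → trans (sumFin-if {n} (adj G₁ a₀ a) _)
                                               (cong (λ s → if adj G₁ a₀ a then s else 0) (sumFin-point {n} b₀ _))))
                       (sym (nbSum≡sumFin G₁ a₀ _))

  □-adj⁻ : ∀ v u → Adj (G₁ □ G₂) v u →
    (quotient {m} n v ≡ quotient {m} n u × Adj G₂ (remainder {m} n v) (remainder {m} n u))
    ⊎ (Adj G₁ (quotient {m} n v) (quotient {m} n u) × remainder {m} n v ≡ remainder {m} n u)
  □-adj⁻ v u v~u with Equivalence.to T-∨ v~u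
  ... | inj₁ same-row with Equivalence.to T-∧ same-row
  ...   | q≡q , r~r = inj₁ (==ᶠ⇒≡ q≡q , r~r)
  □-adj⁻ v u v~u | inj₂ same-col with Equivalence.to T-∧ same-col
  ...   | q~q , r≡r = inj₂ (q~q , ==ᶠ⇒≡ r≡r)

  □-adjʳ : ∀ a b b' → Adj G₂ b b' → Adj (G₁ □ G₂) (combine a b) (combine a b')
  □-adjʳ a b b' b~b'
    rewrite quotient-combine a b | quotient-combine a b' | remainder-combine a b | remainder-combine a b'
          | dec-true (a ≟ᶠ a) refl
    = Equivalence.from T-∨ (inj₁ b~b')

  □-adjˡ : ∀ a a' b → Adj G₁ a a' → Adj (G₁ □ G₂) (combine a b) (combine a' b)
  □-adjˡ a a' b a~a'
    rewrite quotient-combine a b | quotient-combine a' b | remainder-combine a b | remainder-combine a' b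
          | dec-true (b ≟ᶠ b) refl
    = Equivalence.from T-∨ (inj₂ (Equivalence.from T-∧ (a~a' , _)))

-- Colourings of grids given in coordinates

data GridStep : ℕ → ℕ → ℕ → ℕ → Set where
  right : ∀ {i j} → GridStep i j i (suc j)
  left  : ∀ {i j} → GridStep i (suc j) i j
  down  : ∀ {i j} → GridStep i j (suc i) j
  up    : ∀ {i j} → GridStep (suc i) j i j

module Grid (m n : ℕ) where
  grid : Graph
  grid = path m □ path n

  cell : Fin m → Fin n → Fin (m * n)
  cell = combine

  row col : Fin (m * n) → ℕ
  row v = toℕ (quotient {m} n v)
  col v = toℕ (remainder {m} n v)

  row<m : ∀ v → row v < m
  row<m v = toℕ<n (quotient {m} n v)

  col<n : ∀ v → col v < n
  col<n v = toℕ<n (remainder {m} n v)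

  row-combine : ∀ (a : Fin m) (b : Fin n) → row (combine a b) ≡ toℕ a
  row-combine a b = cong toℕ (quotient-combine (path m) (path n) a b)

  col-combine : ∀ (a : Fin m) (b : Fin n) → col (combine a b) ≡ toℕ b
  col-combine a b = cong toℕ (remainder-combine (path m) (path n) a b)

  coordinates-injective : ∀ {u w} → row u ≡ row w → col u ≡ col w → u ≡ w
  coordinates-injective {u} {w} r≡r c≡c = begin
    u                                                   ≡⟨ sym (combine-remQuot {m} n u) ⟩
    combine (quotient {m} n u) (remainder {m} n u)          ≡⟨ cong₂ combine (toℕ-injective r≡r) (toℕ-injective c≡c) ⟩
    combine (quotient {m} n w) (remainder {m} n w)          ≡⟨ combine-remQuot {m} n w ⟩
    w                                                   ∎
    where open ≡-Reasoning

  nbSum-grid : ∀ v (h : Fin (m * n) → ℕ) (g : ℕ → ℕ → ℕ) → (∀ u → h u ≡ g (row u) (col u)) →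
    nbSum grid v h ≡ pathNbSum n (col v) (g (row v)) + pathNbSum m (row v) (λ i → g i (col v))
  nbSum-grid v h g h≗g = trans (nbSum-□ (path m) (path n) v h) (cong₂ _+_
    (nbSum-path n _ _ (g (row v)) λ b → trans (h≗g _) (cong₂ g (row-combine _ b) (col-combine _ b)))
    (nbSum-path m _ _ (λ i → g i (col v)) λ a → trans (h≗g _) (cong₂ g (row-combine a _) (col-combine a _))))

  degree-grid : ∀ v → degree grid v ≡ pathDegree n (col v) + pathDegree m (row v)
  degree-grid v = nbSum-grid v (λ _ → 1) (λ _ _ → 1) (λ _ → refl)

  degree-combine : ∀ (a : Fin m) (b : Fin n) → degree grid (combine a b) ≡ pathDegree n (toℕ b) + pathDegree m (toℕ a)
  degree-combine a b = trans (degree-grid (combine a b))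
    (cong₂ (λ i j → pathDegree n j + pathDegree m i) (row-combine a b) (col-combine a b))

  maxDegree-grid : ∀ {d} (a : Fin m) (b : Fin n) →
    (∀ {i j} → i < m → j < n → pathDegree n j + pathDegree m i ≤ d) →
    pathDegree n (toℕ b) + pathDegree m (toℕ a) ≡ d → maxDegree grid ≡ d
  maxDegree-grid a b deg≤d deg≡d = maxDegree-≡ grid (combine a b)
    (λ v → ≤-trans (≤-reflexive (degree-grid v)) (deg≤d (row<m v) (col<n v))) (trans (degree-combine a b) deg≡d)

  adj⇒step : ∀ {v u} → Adj grid v u → GridStep (row v) (col v) (row u) (col u)
  adj⇒step {v} {u} v~u with □-adj⁻ (path m) (path n) v u v~u
  ... | inj₁ (q≡q , r~r) with path-adj⁻ r~r
  ...   | inj₁ c+1≡c = subst₂ (GridStep (row v) (col v)) (cong toℕ q≡q) c+1≡c right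
  ...   | inj₂ c+1≡c = subst₂ (λ i j → GridStep (row v) j i (col u)) (cong toℕ q≡q) c+1≡c left
  adj⇒step {v} {u} v~u | inj₂ (q~q , r≡r) with path-adj⁻ q~q
  ...   | inj₁ r+1≡r = subst₂ (λ i j → GridStep (row v) (col v) i j) r+1≡r (cong toℕ r≡r) down
  ...   | inj₂ r+1≡r = subst₂ (λ i j → GridStep i (col v) (row u) j) r+1≡r (cong toℕ r≡r) up

-- `h t` is the colour of the edge {t , t + 1} of Pₙ.
pathEdgeSum : ℕ → (ℕ → ℕ) → ℕ → ℕ
pathEdgeSum n h j = before j h + (if suc j <ᵇ n then h j else 0)

-- The colour of the edge between (i , j) and (i' , j'), which share a row or a column.
edgeColour : (ℕ → ℕ → ℕ) → (ℕ → ℕ → ℕ) → ℕ → ℕ → ℕ → ℕ → ℕ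
edgeColour H V i j i' j' = if i ≡ᵇ i' then H i (j ⊓ j') else V (i ⊓ i') j

-- Vertex (i , j) of Pₘ □ Pₙ is `combine i j`; `horizontal i j` colours its edge to (i , j + 1)
-- and `vertical i j` its edge to (i + 1 , j).
record GridColouring (m n k : ℕ) : Set where
  field
    vertex horizontal vertical : ℕ → ℕ → ℕ

  gridSum : ℕ → ℕ → ℕ
  gridSum i j = vertex i j + (pathEdgeSum n (horizontal i) j + pathEdgeSum m (λ t → vertical t j) i)

  field
    vertex-range      : ∀ {i j} → i < m → j < n → InPalette k (vertex i j)
    horizontal-range  : ∀ {i j} → i < m → suc j < n → InPalette k (horizontal i j)
    vertical-range    : ∀ {i j} → suc i < m → j < n → InPalette k (vertical i j)
    vertex-proper-h   : ∀ {i j} → i < m → suc j < n → vertex i j ≢ vertex i (suc j)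
    vertex-proper-v   : ∀ {i j} → suc i < m → j < n → vertex i j ≢ vertex (suc i) j
    horizontal≢ends   : ∀ {i j} → i < m → suc j < n → horizontal i j ≢ vertex i j × horizontal i j ≢ vertex i (suc j)
    vertical≢ends     : ∀ {i j} → suc i < m → j < n → vertical i j ≢ vertex i j × vertical i j ≢ vertex (suc i) j
    horizontal-proper : ∀ {i j} → i < m → suc (suc j) < n → horizontal i j ≢ horizontal i (suc j)
    vertical-proper   : ∀ {i j} → suc (suc i) < m → j < n → vertical i j ≢ vertical (suc i) j
    corner-↖          : ∀ {i j} → suc i < m → suc j < n → horizontal i j ≢ vertical i j
    corner-↗          : ∀ {i j} → suc i < m → suc j < n → horizontal i j ≢ vertical i (suc j)
    corner-↙          : ∀ {i j} → suc i < m → suc j < n → horizontal (suc i) j ≢ vertical i j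
    corner-↘          : ∀ {i j} → suc i < m → suc j < n → horizontal (suc i) j ≢ vertical i (suc j)
    gridSum-proper-h  : ∀ {i j} → i < m → suc j < n → gridSum i j ≢ gridSum i (suc j)
    gridSum-proper-v  : ∀ {i j} → suc i < m → j < n → gridSum i j ≢ gridSum (suc i) j

module _ {m n k : ℕ} (c : GridColouring m n k) where
  open GridColouring c
  open Grid m n

  private
    E = edgeColour horizontal vertical

  stepColour : ∀ {i j i' j'} → GridStep i j i' j' → ℕ
  stepColour (right {i} {j}) = horizontal i j
  stepColour (left  {i} {j}) = horizontal i j
  stepColour (down  {i} {j}) = vertical i j
  stepColour (up    {i} {j}) = vertical i j

  edgeColour-step : ∀ {i j i' j'} (s : GridStep i j i' j') → E i j i' j' ≡ stepColour s
  edgeColour-step (right {i} {j}) rewrite ≡ᵇ-refl i | m≤n⇒m⊓n≡m (n≤1+n j) = refl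
  edgeColour-step (left  {i} {j}) rewrite ≡ᵇ-refl i | m≥n⇒m⊓n≡n (n≤1+n j) = refl
  edgeColour-step (down  {i} {j}) rewrite n≡ᵇ1+n i | m≤n⇒m⊓n≡m (n≤1+n i) = refl
  edgeColour-step (up    {i} {j}) rewrite ≡ᵇ-comm (suc i) i | n≡ᵇ1+n i | m≥n⇒m⊓n≡n (n≤1+n i) = refl

  reverse : ∀ {i j i' j'} → GridStep i j i' j' → GridStep i' j' i j
  reverse right = left
  reverse left  = right
  reverse down  = up
  reverse up    = down

  Within : ℕ → ℕ → Set
  Within i j = i < m × j < n

  step-range : ∀ {i j i' j'} (s : GridStep i j i' j') → Within i j → Within i' j' → InPalette k (stepColour s)
  step-range right (i<m , _) (_ , j'<n) = horizontal-range i<m j'<n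
  step-range left  (i<m , j<n) _        = horizontal-range i<m j<n
  step-range down  _ (i'<m , j<n)       = vertical-range i'<m j<n
  step-range up    (i<m , j<n) _        = vertical-range i<m j<n

  step-vertex : ∀ {i j i' j'} (s : GridStep i j i' j') → Within i j → Within i' j' → vertex i j ≢ vertex i' j'
  step-vertex right (i<m , _) (_ , j'<n) = vertex-proper-h i<m j'<n
  step-vertex left  (i<m , j<n) _        = ≢-sym (vertex-proper-h i<m j<n)
  step-vertex down  _ (i'<m , j<n)       = vertex-proper-v i'<m j<n
  step-vertex up    (i<m , j<n) _        = ≢-sym (vertex-proper-v i<m j<n)

  step-ends : ∀ {i j i' j'} (s : GridStep i j i' j') → Within i j → Within i' j' →
    stepColour s ≢ vertex i j × stepColour s ≢ vertex i' j'
  step-ends right (i<m , _) (_ , j'<n) = horizontal≢ends i<m j'<n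
  step-ends left  (i<m , j<n) _        = let (≢l , ≢r) = horizontal≢ends i<m j<n in ≢r , ≢l
  step-ends down  _ (i'<m , j<n)       = vertical≢ends i'<m j<n
  step-ends up    (i<m , j<n) _        = let (≢u , ≢d) = vertical≢ends i<m j<n in ≢d , ≢u

  step-gridSum : ∀ {i j i' j'} (s : GridStep i j i' j') → Within i j → Within i' j' → gridSum i j ≢ gridSum i' j'
  step-gridSum right (i<m , _) (_ , j'<n) = gridSum-proper-h i<m j'<n
  step-gridSum left  (i<m , j<n) _        = ≢-sym (gridSum-proper-h i<m j<n)
  step-gridSum down  _ (i'<m , j<n)       = gridSum-proper-v i'<m j<n
  step-gridSum up    (i<m , j<n) _        = ≢-sym (gridSum-proper-v i<m j<n)

  steps-proper : ∀ {i j a b c d} (s : GridStep i j a b) (t : GridStep i j c d) → ¬ (a ≡ c × b ≡ d) →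
    Within i j → Within a b → Within c d → stepColour s ≢ stepColour t
  steps-proper right right ≢ _ _ _ = contradiction (refl , refl) ≢
  steps-proper left  left  ≢ _ _ _ = contradiction (refl , refl) ≢
  steps-proper down  down  ≢ _ _ _ = contradiction (refl , refl) ≢
  steps-proper up    up    ≢ _ _ _ = contradiction (refl , refl) ≢
  steps-proper right left  _ (i<m , _) (_ , b<n) _ = ≢-sym (horizontal-proper i<m b<n)
  steps-proper left  right _ (i<m , _) _ (_ , d<n) = horizontal-proper i<m d<n
  steps-proper right down  _ _ (_ , b<n) (c<m , _) = corner-↖ c<m b<n
  steps-proper down  right _ _ (a<m , _) (_ , d<n) = ≢-sym (corner-↖ a<m d<n)
  steps-proper right up    _ (i<m , _) (_ , b<n) _ = corner-↙ i<m b<n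
  steps-proper up    right _ (i<m , _) _ (_ , d<n) = ≢-sym (corner-↙ i<m d<n)
  steps-proper left  down  _ (_ , j<n) _ (c<m , _) = corner-↗ c<m j<n
  steps-proper down  left  _ (_ , j<n) (a<m , _) _ = ≢-sym (corner-↗ a<m j<n)
  steps-proper left  up    _ (i<m , j<n) _ _       = corner-↘ i<m j<n
  steps-proper up    left  _ (i<m , j<n) _ _       = ≢-sym (corner-↘ i<m j<n)
  steps-proper down  up    _ (_ , j<n) (a<m , _) _ = ≢-sym (vertical-proper a<m j<n)
  steps-proper up    down  _ (_ , j<n) _ (c<m , _) = vertical-proper c<m j<n

  stepColour-reverse : ∀ {i j i' j'} (s : GridStep i j i' j') → stepColour (reverse s) ≡ stepColour s
  stepColour-reverse right = refl
  stepColour-reverse left  = refl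
  stepColour-reverse down  = refl
  stepColour-reverse up    = refl

  horizontal-sum : ∀ i j → pathNbSum n j (E i j i) ≡ pathEdgeSum n (horizontal i) j
  horizontal-sum i zero    = cong (λ x → if 1 <ᵇ n then x else 0) (edgeColour-step right)
  horizontal-sum i (suc j) = cong₂ _+_ (edgeColour-step left)
                                       (cong (λ x → if suc (suc j) <ᵇ n then x else 0) (edgeColour-step right))

  vertical-sum : ∀ i j → pathNbSum m i (λ a → E i j a j) ≡ pathEdgeSum m (λ t → vertical t j) i
  vertical-sum zero    j = cong (λ x → if 1 <ᵇ m then x else 0) (edgeColour-step down)
  vertical-sum (suc i) j = cong₂ _+_ (edgeColour-step up)
                                     (cong (λ x → if suc (suc i) <ᵇ m then x else 0) (edgeColour-step down))

  within : ∀ v → Within (row v) (col v)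
  within v = row<m v , col<n v

  edgeColour-adj : ∀ {u v} (u~v : Adj grid u v) → E (row u) (col u) (row v) (col v) ≡ stepColour (adj⇒step u~v)
  edgeColour-adj u~v = edgeColour-step (adj⇒step u~v)

  wsum≡gridSum : ∀ v → vertex (row v) (col v) + nbSum grid v (λ u → E (row v) (col v) (row u) (col u))
                       ≡ gridSum (row v) (col v)
  wsum≡gridSum v = cong (vertex (row v) (col v) +_)
    (trans (nbSum-grid v _ (E (row v) (col v)) (λ _ → refl))
           (cong₂ _+_ (horizontal-sum (row v) (col v)) (vertical-sum (row v) (col v))))

  toColouring : SumDistTotalColouring grid k
  toColouring = record
    { vc = λ v → vertex (row v) (col v)
    ; ec = λ v u → E (row v) (col v) (row u) (col u)
    ; vc-range = λ v → vertex-range (row<m v) (col<n v)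
    ; ec-range = λ u v u~v →
        subst (InPalette k) (sym (edgeColour-adj u~v)) (step-range (adj⇒step u~v) (within u) (within v))
    ; ec-sym = λ u v u~v → trans (edgeColour-adj u~v)
        (trans (sym (stepColour-reverse (adj⇒step u~v))) (sym (edgeColour-step (reverse (adj⇒step u~v)))))
    ; proper-vv = λ u v u~v → step-vertex (adj⇒step u~v) (within u) (within v)
    ; proper-ee = λ v u w v~u v~w u≢w eq → steps-proper (adj⇒step v~u) (adj⇒step v~w)
        (λ (r≡r , c≡c) → u≢w (coordinates-injective r≡r c≡c)) (within v) (within u) (within w)
        (trans (sym (edgeColour-adj v~u)) (trans eq (edgeColour-adj v~w)))
    ; proper-ve = λ u v u~v → let (≢u , ≢v) = step-ends (adj⇒step u~v) (within u) (within v) in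
        (λ eq → ≢u (trans (sym (edgeColour-adj u~v)) eq)) , (λ eq → ≢v (trans (sym (edgeColour-adj u~v)) eq))
    ; distinguishing = λ u v u~v eq → step-gridSum (adj⇒step u~v) (within u) (within v)
        (trans (sym (wsum≡gridSum u)) (trans eq (wsum≡gridSum v)))
    }

-- Striped colourings

EqualOrApart : ℕ → ℕ → Set
EqualOrApart X Y = X ≡ Y ⊎ 3 + X ≤ Y ⊎ 3 + Y ≤ X

EqualOrApart-+ʳ : ∀ W {X Y} → EqualOrApart X Y → EqualOrApart (X + W) (Y + W)
EqualOrApart-+ʳ W (inj₁ X≡Y)           = inj₁ (cong (_+ W) X≡Y)
EqualOrApart-+ʳ W (inj₂ (inj₁ 3+X≤Y)) = inj₂ (inj₁ (+-monoˡ-≤ W 3+X≤Y))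
EqualOrApart-+ʳ W (inj₂ (inj₂ 3+Y≤X)) = inj₂ (inj₂ (+-monoˡ-≤ W 3+Y≤X))

EqualOrApart-+ˡ : ∀ W {X Y} → EqualOrApart X Y → EqualOrApart (W + X) (W + Y)
EqualOrApart-+ˡ W {X} {Y} = subst₂ EqualOrApart (+-comm X W) (+-comm Y W) ∘ EqualOrApart-+ʳ W

small-shift-≢ : ∀ {c c' X Y} → c ≢ c' → c ≤ 2 → c' ≤ 2 → EqualOrApart X Y → c + X ≢ c' + Y
small-shift-≢ {c} {c'} {X} c≢c' _ _ (inj₁ refl) eq = c≢c' (+-cancelʳ-≡ X c c' eq)
small-shift-≢ {c} {c'} {X} {Y} _ c≤2 _ (inj₂ (inj₁ 3+X≤Y)) eq = contradiction
  (≤-trans (+-cancelʳ-≤ X 3 c (≤-trans 3+X≤Y (≤-trans (m≤n+m Y c') (≤-reflexive (sym eq))))) c≤2) 1+n≰n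
small-shift-≢ {c} {c'} {X} {Y} _ _ c'≤2 (inj₂ (inj₂ 3+Y≤X)) eq = contradiction
  (≤-trans (+-cancelʳ-≤ Y 3 c' (≤-trans 3+Y≤X (≤-trans (m≤n+m X c) (≤-reflexive eq)))) c'≤2) 1+n≰n

pathEdgeSum-apart : ∀ n (h : ℕ → ℕ) → (∀ t → h (suc (suc t)) ≡ h t) → (∀ t → 3 ≤ h t) →
  ∀ j → suc j < n → EqualOrApart (pathEdgeSum n h j) (pathEdgeSum n h (suc j))
pathEdgeSum-apart n h periodic 3≤h zero 1<n rewrite <ᵇ-true 1<n with 2 <ᵇ n
... | true  = inj₂ (inj₁ (subst (3 + h 0 ≤_) (+-comm (h 1) (h 0)) (+-mono-≤ (3≤h 1) ≤-refl)))
... | false = inj₁ (sym (+-identityʳ (h 0)))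
pathEdgeSum-apart n h periodic 3≤h (suc j) 2+j<n rewrite <ᵇ-true 2+j<n with suc (suc (suc j)) <ᵇ n
... | true  = inj₁ (trans (+-comm (h j) (h (suc j))) (cong (h (suc j) +_) (sym (periodic j))))
... | false = inj₂ (inj₂ (+-mono-≤ (3≤h j) (≤-reflexive (+-identityʳ (h (suc j))))))

alternate : ℕ → ℕ → ℕ → ℕ
alternate x y zero    = x
alternate x y (suc t) = alternate y x t

alternate-preserves : ∀ {P : ℕ → Set} {x y} → P x → P y → ∀ t → P (alternate x y t)
alternate-preserves px py zero    = px
alternate-preserves {P} px py (suc t) = alternate-preserves {P} py px t

alternate-≢-suc : ∀ {x y} → x ≢ y → ∀ t → alternate x y t ≢ alternate x y (suc t)
alternate-≢-suc x≢y zero    = x≢y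
alternate-≢-suc x≢y (suc t) = alternate-≢-suc (≢-sym x≢y) t

alternate-≤ : ∀ {x y k N} → x ≤ k → (3 ≤ N → y ≤ k) → ∀ t → suc t < N → alternate x y t ≤ k
alternate-≤ x≤k y≤k zero                _     = x≤k
alternate-≤ x≤k y≤k (suc zero)          2<N   = y≤k 2<N
alternate-≤ x≤k y≤k (suc (suc t)) 3+t<N       = alternate-≤ x≤k y≤k t (<⇒≤ (<⇒≤ 3+t<N))

≥3⇒≢≤2 : ∀ {e c} → 3 ≤ e → c ≤ 2 → e ≢ c
≥3⇒≢≤2 3≤e c≤2 refl = 1+n≰n (≤-trans 3≤e c≤2)

record StripePalette (m n k : ℕ) : Set where
  field
    a b p q : ℕ
    3≤a : 3 ≤ a
    3≤b : 3 ≤ b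
    3≤p : 3 ≤ p
    3≤q : 3 ≤ q
    a≢b : a ≢ b
    p≢q : p ≢ q
    a≢p : a ≢ p
    a≢q : a ≢ q
    b≢p : b ≢ p
    b≢q : b ≢ q
    a≤k : a ≤ k
    p≤k : p ≤ k
    b≤k : 3 ≤ n → b ≤ k
    q≤k : 3 ≤ m → q ≤ k

module _ {m n k : ℕ} (P : StripePalette m n k) where
  open StripePalette P

  private
    chessboard : ℕ → ℕ
    chessboard = alternate 1 2

    chessboard≤2 : ∀ t → chessboard t ≤ 2
    chessboard≤2 = alternate-preserves {_≤ 2} (s≤s z≤n) ≤-refl

    3≤k : 3 ≤ k
    3≤k = ≤-trans 3≤a a≤k

    3≤row : ∀ t → 3 ≤ alternate a b t
    3≤row = alternate-preserves {3 ≤_} 3≤a 3≤b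

    3≤col : ∀ t → 3 ≤ alternate p q t
    3≤col = alternate-preserves {3 ≤_} 3≤p 3≤q

    horizontal≢vertical : ∀ i j → alternate a b j ≢ alternate p q i
    horizontal≢vertical i = alternate-preserves {_≢ alternate p q i}
      (alternate-preserves {a ≢_} a≢p a≢q i) (alternate-preserves {b ≢_} b≢p b≢q i)

    3≤⇒1≤ : ∀ {e} → 3 ≤ e → 1 ≤ e
    3≤⇒1≤ = ≤-trans (s≤s z≤n)

  striped : GridColouring m n k
  striped = record
    { vertex     = λ i j → chessboard (i + j)
    ; horizontal = λ _ j → alternate a b j
    ; vertical   = λ i _ → alternate p q i
    ; vertex-range     = λ {i} {j} _ _ → alternate-preserves {InPalette k}
        (s≤s z≤n , ≤-trans (s≤s z≤n) 3≤k) (s≤s z≤n , ≤-trans (s≤s (s≤s z≤n)) 3≤k) (i + j)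
    ; horizontal-range = λ {_} {j} _ 1+j<n → 3≤⇒1≤ (3≤row j) , alternate-≤ a≤k b≤k j 1+j<n
    ; vertical-range   = λ {i} 1+i<m _ → 3≤⇒1≤ (3≤col i) , alternate-≤ p≤k q≤k i 1+i<m
    ; vertex-proper-h  = λ {i} {j} _ _ → subst (λ t → chessboard (i + j) ≢ chessboard t) (sym (+-suc i j))
        (alternate-≢-suc (λ ()) (i + j))
    ; vertex-proper-v  = λ {i} {j} _ _ → alternate-≢-suc (λ ()) (i + j)
    ; horizontal≢ends  = λ {i} {j} _ _ →
        ≥3⇒≢≤2 (3≤row j) (chessboard≤2 (i + j)) , ≥3⇒≢≤2 (3≤row j) (chessboard≤2 (i + suc j))
    ; vertical≢ends    = λ {i} {j} _ _ →
        ≥3⇒≢≤2 (3≤col i) (chessboard≤2 (i + j)) , ≥3⇒≢≤2 (3≤col i) (chessboard≤2 (suc i + j))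
    ; horizontal-proper = λ {_} {j} _ _ → alternate-≢-suc a≢b j
    ; vertical-proper   = λ {i} _ _ → alternate-≢-suc p≢q i
    ; corner-↖ = λ {i} {j} _ _ → horizontal≢vertical i j
    ; corner-↗ = λ {i} {j} _ _ → horizontal≢vertical i j
    ; corner-↙ = λ {i} {j} _ _ → horizontal≢vertical i j
    ; corner-↘ = λ {i} {j} _ _ → horizontal≢vertical i j
    ; gridSum-proper-h = λ {i} {j} _ 1+j<n → small-shift-≢
        (subst (λ t → chessboard (i + j) ≢ chessboard t) (sym (+-suc i j)) (alternate-≢-suc (λ ()) (i + j)))
        (chessboard≤2 (i + j)) (chessboard≤2 (i + suc j))
        (EqualOrApart-+ʳ (pathEdgeSum m (alternate p q) i)
          (pathEdgeSum-apart n (alternate a b) (λ _ → refl) 3≤row j 1+j<n))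
    ; gridSum-proper-v = λ {i} {j} 1+i<m _ → small-shift-≢
        (alternate-≢-suc (λ ()) (i + j)) (chessboard≤2 (i + j)) (chessboard≤2 (suc i + j))
        (EqualOrApart-+ˡ (pathEdgeSum n (alternate a b) j)
          (pathEdgeSum-apart m (alternate p q) (λ _ → refl) 3≤col i 1+i<m))
    }

-- The grid P₃ □ P₃

index : ∀ {A : Set} → A → List A → ℕ → A
index d []       _       = d
index d (x ∷ xs) zero    = x
index d (x ∷ xs) (suc i) = index d xs i

table : List (List ℕ) → ℕ → ℕ → ℕ
table rows i j = index 0 (index [] rows i) j

decideBelow₂ : ∀ {P : ℕ → ℕ → Set} (P? : ∀ i j → Dec (P i j)) a b →
  {True (allUpTo? (λ i → allUpTo? (P? i) b) a)} → ∀ {i j} → i < a → j < b → P i j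
decideBelow₂ P? a b {t} i<a j<b = toWitness t i<a j<b

vertex₃ horizontal₃ vertical₃ : ℕ → ℕ → ℕ
vertex₃     = table ((1 ∷ 2 ∷ 1 ∷ []) ∷ (2 ∷ 1 ∷ 2 ∷ []) ∷ (1 ∷ 4 ∷ 3 ∷ []) ∷ [])
horizontal₃ = table ((3 ∷ 4 ∷ []) ∷ (3 ∷ 4 ∷ []) ∷ (3 ∷ 5 ∷ []) ∷ [])
vertical₃   = table ((4 ∷ 5 ∷ 3 ∷ []) ∷ (5 ∷ 2 ∷ 1 ∷ []) ∷ [])

gridSum₃ : ℕ → ℕ → ℕ
gridSum₃ i j = vertex₃ i j + (pathEdgeSum 3 (horizontal₃ i) j + pathEdgeSum 3 (λ t → vertical₃ t j) i)

inPalette? : ∀ k x → Dec (InPalette k x)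
inPalette? k x = (1 ≤? x) ×-dec (x ≤? k)

_≢?_ : ∀ (x y : ℕ) → Dec (x ≢ y)
x ≢? y = ¬? (x ≟ y)

grid₃ : GridColouring 3 3 5
grid₃ = record
  { vertex = vertex₃ ; horizontal = horizontal₃ ; vertical = vertical₃
  ; vertex-range      = decideBelow₂ (λ i j → inPalette? 5 (vertex₃ i j)) 3 3
  ; horizontal-range  = λ i<3 j+1<3 → decideBelow₂ (λ i j → inPalette? 5 (horizontal₃ i j)) 3 2 i<3 (s≤s⁻¹ j+1<3)
  ; vertical-range    = λ i+1<3 j<3 → decideBelow₂ (λ i j → inPalette? 5 (vertical₃ i j)) 2 3 (s≤s⁻¹ i+1<3) j<3
  ; vertex-proper-h   = λ i<3 j+1<3 → decideBelow₂ (λ i j → vertex₃ i j ≢? vertex₃ i (suc j)) 3 2 i<3 (s≤s⁻¹ j+1<3)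
  ; vertex-proper-v   = λ i+1<3 j<3 → decideBelow₂ (λ i j → vertex₃ i j ≢? vertex₃ (suc i) j) 2 3 (s≤s⁻¹ i+1<3) j<3
  ; horizontal≢ends   = λ i<3 j+1<3 →
      decideBelow₂ (λ i j → (horizontal₃ i j ≢? vertex₃ i j) ×-dec (horizontal₃ i j ≢? vertex₃ i (suc j))) 3 2 i<3 (s≤s⁻¹ j+1<3)
  ; vertical≢ends     = λ i+1<3 j<3 →
      decideBelow₂ (λ i j → (vertical₃ i j ≢? vertex₃ i j) ×-dec (vertical₃ i j ≢? vertex₃ (suc i) j)) 2 3 (s≤s⁻¹ i+1<3) j<3
  ; horizontal-proper = λ i<3 j+2<3 → decideBelow₂ (λ i j → horizontal₃ i j ≢? horizontal₃ i (suc j)) 3 1 i<3 (s≤s⁻¹ (s≤s⁻¹ j+2<3))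
  ; vertical-proper   = λ i+2<3 j<3 → decideBelow₂ (λ i j → vertical₃ i j ≢? vertical₃ (suc i) j) 1 3 (s≤s⁻¹ (s≤s⁻¹ i+2<3)) j<3
  ; corner-↖ = λ i+1<3 j+1<3 → decideBelow₂ (λ i j → horizontal₃ i j ≢? vertical₃ i j) 2 2 (s≤s⁻¹ i+1<3) (s≤s⁻¹ j+1<3)
  ; corner-↗ = λ i+1<3 j+1<3 → decideBelow₂ (λ i j → horizontal₃ i j ≢? vertical₃ i (suc j)) 2 2 (s≤s⁻¹ i+1<3) (s≤s⁻¹ j+1<3)
  ; corner-↙ = λ i+1<3 j+1<3 → decideBelow₂ (λ i j → horizontal₃ (suc i) j ≢? vertical₃ i j) 2 2 (s≤s⁻¹ i+1<3) (s≤s⁻¹ j+1<3)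
  ; corner-↘ = λ i+1<3 j+1<3 → decideBelow₂ (λ i j → horizontal₃ (suc i) j ≢? vertical₃ i (suc j)) 2 2 (s≤s⁻¹ i+1<3) (s≤s⁻¹ j+1<3)
  ; gridSum-proper-h  = λ i<3 j+1<3 → decideBelow₂ (λ i j → gridSum₃ i j ≢? gridSum₃ i (suc j)) 3 2 i<3 (s≤s⁻¹ j+1<3)
  ; gridSum-proper-v  = λ i+1<3 j<3 → decideBelow₂ (λ i j → gridSum₃ i j ≢? gridSum₃ (suc i) j) 2 3 (s≤s⁻¹ i+1<3) j<3
  }

≤-lit : ∀ {m n} {_ : T (m ≤ᵇ n)} → m ≤ n
≤-lit {m} {n} {m≤ᵇn} = ≤ᵇ⇒≤ m n m≤ᵇn

P₂□P₂-chromatic : IsTotalSumChromatic (path 2 □ path 2) (maxDegree (path 2 □ path 2) + 2)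
P₂□P₂-chromatic = chromatic-Δ+2 (cell fzero fzero) (cell fzero (fsuc fzero))
  (maxDegree-grid fzero fzero (λ i<2 j<2 → +-mono-≤ (pathDegree-P₂ _ j<2) (pathDegree-P₂ _ i<2)) refl)
  (toColouring (striped palette))
  (□-adjʳ (path 2) (path 2) fzero fzero (fsuc fzero) _)
  (degree-combine fzero fzero) (degree-combine fzero (fsuc fzero))
  where
  open Grid 2 2
  palette : StripePalette 2 2 4
  palette = record
    { a = 3 ; b = 5 ; p = 4 ; q = 6
    ; 3≤a = ≤-lit ; 3≤b = ≤-lit ; 3≤p = ≤-lit ; 3≤q = ≤-lit
    ; a≢b = λ () ; p≢q = λ () ; a≢p = λ () ; a≢q = λ () ; b≢p = λ () ; b≢q = λ ()
    ; a≤k = ≤-lit ; p≤k = ≤-lit ; b≤k = λ { (s≤s (s≤s ())) } ; q≤k = λ { (s≤s (s≤s ())) }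
    }

P₂□Pₙ-chromatic : ∀ b → let G = path 2 □ path (3 + b) in IsTotalSumChromatic G (maxDegree G + 2)
P₂□Pₙ-chromatic b = chromatic-Δ+2 (cell fzero (fsuc fzero)) (cell (fsuc fzero) (fsuc fzero))
  (maxDegree-grid fzero (fsuc fzero) (λ {_} {j} i<2 _ → +-mono-≤ (pathDegree≤2 n j) (pathDegree-P₂ _ i<2)) refl)
  (toColouring (striped palette))
  (□-adjˡ (path 2) (path n) fzero (fsuc fzero) (fsuc fzero) _)
  (degree-combine fzero (fsuc fzero)) (degree-combine (fsuc fzero) (fsuc fzero))
  where
  n = 3 + b
  open Grid 2 n
  palette : StripePalette 2 n 5
  palette = record
    { a = 3 ; b = 4 ; p = 5 ; q = 6
    ; 3≤a = ≤-lit ; 3≤b = ≤-lit ; 3≤p = ≤-lit ; 3≤q = ≤-lit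
    ; a≢b = λ () ; p≢q = λ () ; a≢p = λ () ; a≢q = λ () ; b≢p = λ () ; b≢q = λ ()
    ; a≤k = ≤-lit ; p≤k = ≤-lit ; b≤k = λ _ → ≤-lit ; q≤k = λ { (s≤s (s≤s ())) }
    }

Pₘ□P₂-chromatic : ∀ a → let G = path (3 + a) □ path 2 in IsTotalSumChromatic G (maxDegree G + 2)
Pₘ□P₂-chromatic a = chromatic-Δ+2 (cell (fsuc fzero) fzero) (cell (fsuc fzero) (fsuc fzero))
  (maxDegree-grid (fsuc fzero) fzero (λ {i} _ j<2 → +-mono-≤ (pathDegree-P₂ _ j<2) (pathDegree≤2 m i)) refl)
  (toColouring (striped palette))
  (□-adjʳ (path m) (path 2) (fsuc fzero) fzero (fsuc fzero) _)
  (degree-combine (fsuc fzero) fzero) (degree-combine (fsuc fzero) (fsuc fzero))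
  where
  m = 3 + a
  open Grid m 2
  palette : StripePalette m 2 5
  palette = record
    { a = 3 ; b = 6 ; p = 4 ; q = 5
    ; 3≤a = ≤-lit ; 3≤b = ≤-lit ; 3≤p = ≤-lit ; 3≤q = ≤-lit
    ; a≢b = λ () ; p≢q = λ () ; a≢p = λ () ; a≢q = λ () ; b≢p = λ () ; b≢q = λ ()
    ; a≤k = ≤-lit ; p≤k = ≤-lit ; b≤k = λ { (s≤s (s≤s ())) } ; q≤k = λ _ → ≤-lit
    }

P₃□P₃-chromatic : IsTotalSumChromatic (path 3 □ path 3) (maxDegree (path 3 □ path 3) + 1)
P₃□P₃-chromatic = chromatic-Δ+1 (cell (fsuc fzero) (fsuc fzero))
  (maxDegree-grid (fsuc fzero) (fsuc fzero) (λ {i} {j} _ _ → +-mono-≤ (pathDegree≤2 3 j) (pathDegree≤2 3 i)) refl)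
  (toColouring grid₃) (degree-combine (fsuc fzero) (fsuc fzero))
  where open Grid 3 3

large-palette : ∀ m n → StripePalette m n 6
large-palette m n = record
  { a = 3 ; b = 4 ; p = 5 ; q = 6
  ; 3≤a = ≤-lit ; 3≤b = ≤-lit ; 3≤p = ≤-lit ; 3≤q = ≤-lit
  ; a≢b = λ () ; p≢q = λ () ; a≢p = λ () ; a≢q = λ () ; b≢p = λ () ; b≢q = λ ()
  ; a≤k = ≤-lit ; p≤k = ≤-lit ; b≤k = λ _ → ≤-lit ; q≤k = λ _ → ≤-lit
  }

maxDegree-large : ∀ a b → maxDegree (path (3 + a) □ path (3 + b)) ≡ 4
maxDegree-large a b = Grid.maxDegree-grid (3 + a) (3 + b) (fsuc fzero) (fsuc fzero)
  (λ {i} {j} _ _ → +-mono-≤ (pathDegree≤2 (3 + b) j) (pathDegree≤2 (3 + a) i)) refl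

P₃₊□P₄₊-chromatic : ∀ a b → let G = path (3 + a) □ path (4 + b) in IsTotalSumChromatic G (maxDegree G + 2)
P₃₊□P₄₊-chromatic a b = chromatic-Δ+2 (cell (fsuc fzero) (fsuc fzero)) (cell (fsuc fzero) (fsuc (fsuc fzero)))
  (maxDegree-large a (suc b)) (toColouring (striped (large-palette (3 + a) (4 + b))))
  (□-adjʳ (path (3 + a)) (path (4 + b)) (fsuc fzero) (fsuc fzero) (fsuc (fsuc fzero)) _)
  (degree-combine (fsuc fzero) (fsuc fzero)) (degree-combine (fsuc fzero) (fsuc (fsuc fzero)))
  where open Grid (3 + a) (4 + b)

P₄₊□P₃-chromatic : ∀ a → let G = path (4 + a) □ path 3 in IsTotalSumChromatic G (maxDegree G + 2)
P₄₊□P₃-chromatic a = chromatic-Δ+2 (cell (fsuc fzero) (fsuc fzero)) (cell (fsuc (fsuc fzero)) (fsuc fzero))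
  (maxDegree-large (suc a) 0) (toColouring (striped (large-palette (4 + a) 3)))
  (□-adjˡ (path (4 + a)) (path 3) (fsuc fzero) (fsuc (fsuc fzero)) (fsuc fzero) _)
  (degree-combine (fsuc fzero) (fsuc fzero)) (degree-combine (fsuc (fsuc fzero)) (fsuc fzero))
  where open Grid (4 + a) 3

theorem4p1 : ∀ (m n : ℕ) → 2 ≤ m → 2 ≤ n →
    ((m ≡ 3 × n ≡ 3) →
      IsTotalSumChromatic (path m □ path n) (maxDegree (path m □ path n) + 1))
    × (¬ (m ≡ 3 × n ≡ 3) →
      IsTotalSumChromatic (path m □ path n) (maxDegree (path m □ path n) + 2))
theorem4p1 2 2 _ _ = (λ { (() , _) }) , λ _ → P₂□P₂-chromatic
theorem4p1 2 (suc (suc (suc b))) _ _ = (λ { (() , _) }) , λ _ → P₂□Pₙ-chromatic b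
theorem4p1 (suc (suc (suc a))) 2 _ _ = (λ { (_ , ()) }) , λ _ → Pₘ□P₂-chromatic a
theorem4p1 3 3 _ _ = (λ _ → P₃□P₃-chromatic) , λ not-3×3 → contradiction (refl , refl) not-3×3
theorem4p1 (suc (suc (suc a))) (suc (suc (suc (suc b)))) _ _ = (λ { (_ , ()) }) , λ _ → P₃₊□P₄₊-chromatic a b
theorem4p1 (suc (suc (suc (suc a)))) 3 _ _ = (λ { (() , _) }) , λ _ → P₄₊□P₃-chromatic a
theorem4p1 1 _ (s≤s ()) _
theorem4p1 _ 1 _ (s≤s ())
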